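{- Let $\Pi=(D;<_1,<_2)$ be the random permutation and let ${\mathscr G}$ be a closed permutation group on $D$ with $\operatorname{Aut}(\Pi)\subseteq{\mathscr G}$. Let $c_1,\ldots,c_n\in D$ and let $g\colon D\to D$ be a function mon-generated by ${\mathscr G}$ which is canonical as a function from $(\Pi,c_1,\ldots,c_n)$ to $\Pi$. Suppose $g$ diagonalizes infinite orbits $X,Y$ of $\operatorname{Aut}(\Pi,c_1,\ldots,c_n)$ which are not in diagonal position. Then $\operatorname{Aut}(D;<_i)\subseteq{\mathscr G}$ for some $i\in\{1,2\}$.
   Context: The random permutation $\Pi=(D;<_1,<_2)$ is the countable homogeneous structure with two linear orders (Fraïssé limit of finite sets with two linear orders). $\operatorname{Aut}(D;<_i)$ is the group of permutations of $D$ preserving $<_i$. A permutation group on $D$ is closed if closed in the pointwise convergence topology on the symmetric group of $D$. A function $f\colon D\to D$ is mon-generated by a set $F$ of functions if for every finite $A\subseteq D$ some composition of functions from $F$ agrees with $f$ on $A$. $\operatorname{Aut}(\Pi,c_1,\ldots,c_n)$ is the group of automorphisms of $\Pi$ fixing each $c_k$. A function $g$ is canonical from $(\Pi,c_1,\ldots,c_n)$ to $\Pi$ if tuples with the same type in the expansion $(\Pi,c_1,\ldots,c_n)$ are mapped by $g$ to tuples with the same type in $\Pi$. Define $\mathrm{up}(x,y)\iff x<_1y\wedge x<_2y$, $\mathrm{st}(x,y)\iff\mathrm{up}(x,y)\vee\mathrm{up}(y,x)$, $\mathrm{tw}(x,y)\iff\neg\mathrm{st}(x,y)$. Disjoint sets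 $X,Y$ are in diagonal position if either $\mathrm{st}(x,y)$ for all $x\in X,y\in Y$, or $\mathrm{tw}(x,y)$ for all $x\in X,y\in Y$; $g$ diagonalizes $X,Y$ if $g[X],g[Y]$ are in diagonal position. -}

module Defs where

open import Level using (0ℓ)
open import Data.Nat using (ℕ)
open import Data.Fin using (Fin)
open import Data.List using (List; []; _∷_; foldr)
open import Data.List.Relation.Unary.All using (All)
open import Data.List.Membership.Propositional using (_∈_)
open import Data.Product using (Σ; ∃; ∃-syntax; _×_; _,_)
open import Data.Sum using (_⊎_)
open import Data.Empty using (⊥)
open import Relation.Nullary using (¬_)
open import Relation.Binary.PropositionalEquality using (_≡_)
open import Relation.Binary.Structures using (IsStrictTotalOrder)
open import Function using (_∘_; id)
open import Function.Bundles using (_⇔_)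
open import Data.Vec.Functional using (Vector; _++_)

record Perm (D : Set) : Set where
  field
    fwd : D → D
    bwd : D → D
    fwd∘bwd : ∀ x → fwd (bwd x) ≡ x
    bwd∘fwd : ∀ x → bwd (fwd x) ≡ x
open Perm public

composeAll : {D : Set} → List (Perm D) → D → D
composeAll = foldr (λ p h → fwd p ∘ h) id

AgreeOn : {D : Set} → (D → D) → (D → D) → List D → Set
AgreeOn f h A = All (λ a → f a ≡ h a) A

record IsPermGroup {D : Set} (G : Perm D → Set) : Set where
  field
    id∈    : ∀ (p : Perm D) → (∀ x → fwd p x ≡ x) → G p
    comp∈  : ∀ (p q r : Perm D) → G p → G q → (∀ x → fwd r x ≡ fwd p (fwd q x)) → G r
    inv∈   : ∀ (p r : Perm D) → G p → (∀ x → fwd r x ≡ bwd p x) → G r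

-- Closed in the topology of pointwise convergence on Sym(D):
-- every permutation in the closure (every basic neighbourhood
-- {q | q agrees with p on finite A} meets G) belongs to G.
IsClosedPermGroup : {D : Set} → (Perm D → Set) → Set
IsClosedPermGroup {D} G =
  IsPermGroup G ×
  (∀ (p : Perm D) → (∀ (A : List D) → Σ (Perm D) λ h → G h × AgreeOn (fwd h) (fwd p) A) → G p)

MonGenerated : {D : Set} → (Perm D → Set) → (D → D) → Set
MonGenerated {D} G f =
  ∀ (A : List D) → Σ (List (Perm D)) λ hs → All G hs × AgreeOn (composeAll hs) f A

Countable : Set → Set
Countable D = Σ (ℕ → D) λ e → ∀ d → ∃[ n ] e n ≡ d

module BiOrder {D : Set} (_<₁_ _<₂_ : D → D → Set) where

  PreservesRel : (D → D → Set) → Perm D → Set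
  PreservesRel R p = ∀ x y → (R x y ⇔ R (fwd p x) (fwd p y))

  IsAut : Perm D → Set
  IsAut p = PreservesRel _<₁_ p × PreservesRel _<₂_ p

  IsAut₁ IsAut₂ : Perm D → Set
  IsAut₁ = PreservesRel _<₁_
  IsAut₂ = PreservesRel _<₂_

  SameType : {m : ℕ} → Vector D m → Vector D m → Set
  SameType a b = ∀ i j →
    (a i ≡ a j ⇔ b i ≡ b j) × (a i <₁ a j ⇔ b i <₁ b j) × (a i <₂ a j ⇔ b i <₂ b j)

  -- Π is the random permutation: countable, two strict linear orders,
  -- homogeneous, with age the class of all finite sets with two linear orders.
  record IsRandomPermutation : Set₁ where
    field
      countable : Countable D
      order₁ : IsStrictTotalOrder _≡_ _<₁_
      order₂ : IsStrictTotalOrder _≡_ _<₂_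
      homogeneous : ∀ {m} (a b : Vector D m) → SameType a b →
        Σ (Perm D) λ α → IsAut α × (∀ i → fwd α (a i) ≡ b i)
      universal : ∀ {k} (R₁ R₂ : Fin k → Fin k → Set) →
        IsStrictTotalOrder _≡_ R₁ → IsStrictTotalOrder _≡_ R₂ →
        Σ (Fin k → D) λ e → (∀ i j → e i ≡ e j → i ≡ j) ×
          (∀ i j → (R₁ i j ⇔ e i <₁ e j)) × (∀ i j → (R₂ i j ⇔ e i <₂ e j))

  module _ {n : ℕ} (c : Vector D n) where

    IsAutC : Perm D → Set
    IsAutC p = IsAut p × (∀ k → fwd p (c k) ≡ c k)

    SameTypeC : {m : ℕ} → Vector D m → Vector D m → Set
    SameTypeC a b = SameType (a ++ c) (b ++ c)

    Canonical : (D → D) → Set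
    Canonical g = ∀ {m} (a b : Vector D m) → SameTypeC a b → SameType (g ∘ a) (g ∘ b)

    Orbit : D → D → Set
    Orbit x y = Σ (Perm D) λ α → IsAutC α × fwd α x ≡ y

  Infinite : (D → Set) → Set
  Infinite X = ∀ (l : List D) → Σ D λ y → X y × ¬ (y ∈ l)

  Disjoint : (D → Set) → (D → Set) → Set
  Disjoint X Y = ∀ z → X z → Y z → ⊥

  up st tw : D → D → Set
  up x y = x <₁ y × x <₂ y
  st x y = up x y ⊎ up y x
  tw x y = ¬ st x y

  DiagonalPosition : (D → Set) → (D → Set) → Set
  DiagonalPosition X Y = Disjoint X Y ×
    ((∀ x y → X x → Y y → st x y) ⊎ (∀ x y → X x → Y y → tw x y))

  Image : (D → D) → (D → Set) → D → Set
  Image g X z = Σ D λ x → X x × g x ≡ z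

  Diagonalizes : (D → D) → (D → Set) → (D → Set) → Set
  Diagonalizes g X Y = DiagonalPosition (Image g X) (Image g Y)

-- By homogeneity, the orbits of Aut(Π, c) on non-constants consist of the points lying in the same
-- cuts of both orders with respect to the constants. If no constant separated x and y in either
-- order their orbits X, Y would coincide, and if constants separated them in both orders X, Y would
-- already be in diagonal position. So, after swapping the orders if necessary, x and y lie in the
-- same <₁-cut and a constant separates them in <₂: then X lies <₂-below Y, while <₁ between X and Y
-- is unconstrained. As g diagonalizes X and Y, it either maps cross pairs u <₁ v and v <₁ u to pairs
-- of the same type, or reverses both orders between them. In the first case g forgets <₁ across X
-- and Y, and moving the points of a tuple across the split lets G sort any tuple until its <₁-order
-- agrees with its <₂-order, so Aut(D;<₂) ⊆ G. In the second case a point of X placed between two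
-- points of Y shows that g maps all <₁-increasing pairs of Y alike, forgetting <₂ there, so
-- Aut(D;<₁) ⊆ G. Throughout, G relates any two tuples whose g-images have the same type, because g
-- agrees with an element of G on finite sets; closedness of G turns these finite statements into
-- the inclusions.
module Submission where

open import Defs
open import Data.Bool using (Bool; true; false; not)
import Data.Bool as Bool
import Data.Bool.Properties as Bool
open import Data.Empty using (⊥; ⊥-elim)
open import Data.Fin using (Fin; zero; suc; splitAt; join) renaming (_<_ to _<ᶠ_; _≟_ to _≟ᶠ_)
import Data.Fin.Properties as Fin
open import Data.Fin.Properties using (splitAt-join; join-splitAt; any?; all?; ¬∀⟶∃¬)
open import Data.List using (List; []; _∷_; [_]; _++_; tabulate; lookup; allFin)
open import Data.List.Membership.Propositional using (_∈_)
open import Data.List.Membership.Propositional.Properties using (∈-allFin)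
import Data.List.Relation.Unary.All as All
open import Data.List.Relation.Unary.All using (All; []; _∷_)
import Data.List.Relation.Unary.All.Properties as All
import Data.List.Relation.Unary.Any as Any
open import Data.List.Relation.Unary.Any using (here)
open import Data.List.Relation.Unary.Any.Properties using (lookup-index)
open import Data.Nat using (ℕ; zero; suc; z<s; s<s)
import Data.Product as Product
open import Data.Product using (Σ; ∃-syntax; _×_; _,_; proj₁; proj₂)
open import Data.Product.Relation.Binary.Lex.Strict using (×-Lex; ×-isStrictTotalOrder)
import Data.Sum as ⊎
open import Data.Sum using (_⊎_; inj₁; inj₂)
open import Data.Sum.Properties using (inj₁-injective; inj₂-injective)
open import Data.Vec.Functional using (Vector) renaming (_∷_ to _∷ᵛ_; [] to []ᵛ)
open import Function using (_on_)
open import Function.Bundles using (_⇔_; mk⇔; Equivalence)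
open import Function.Definitions using (Injective)
import Function.Properties.Equivalence as ⇔
import Relation.Binary.Construct.Flip.Ord as Flip
open import Relation.Binary.Definitions using (Tri; tri<; tri≈; tri>)
open import Relation.Binary.PropositionalEquality
  using (_≡_; _≢_; refl; sym; trans; cong; subst; subst₂; isEquivalence; module ≡-Reasoning)
open import Relation.Binary.Structures using (IsStrictTotalOrder)
open import Relation.Nullary using (¬_; Dec; yes; no; does)
open import Relation.Nullary.Decidable using (dec-true; dec-false)

open Equivalence using (to; from)

infixr 5 _⟨⇔⟩_
_⟨⇔⟩_ : {A B C : Set} → A ⇔ B → B ⇔ C → A ⇔ C
_⟨⇔⟩_ = ⇔.trans

_⇔?_ : {P Q : Set} → Dec P → Dec Q → Dec (P ⇔ Q)
yes p ⇔? yes q = yes (mk⇔ (λ _ → q) (λ _ → p))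
no ¬p ⇔? no ¬q = yes (mk⇔ (λ p → ⊥-elim (¬p p)) (λ q → ⊥-elim (¬q q)))
yes p ⇔? no ¬q = no (λ e → ¬q (to e p))
no ¬p ⇔? yes q = no (λ e → ¬p (from e q))

agree? : {A A′ : Set} → Dec A → Dec A′ → (A ⇔ A′) ⊎ (A′ ⇔ (¬ A))
agree? (yes a) (yes a′) = inj₁ (mk⇔ (λ _ → a′) (λ _ → a))
agree? (no ¬a) (no ¬a′) = inj₁ (mk⇔ (λ a → ⊥-elim (¬a a)) (λ a′ → ⊥-elim (¬a′ a′)))
agree? (yes a) (no ¬a′) = inj₂ (mk⇔ (λ a′ → ⊥-elim (¬a′ a′)) (λ ¬a → ⊥-elim (¬a a)))
agree? (no ¬a) (yes a′) = inj₂ (mk⇔ (λ _ → ¬a) (λ _ → a′))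

private
  oneFlip : {A B A′ B′ : Set} → Dec A → Dec B → (A ⇔ A′) → (B′ ⇔ (¬ B)) →
    ¬ ((A ⇔ B) ⇔ (A′ ⇔ B′))
  oneFlip (yes a) (yes b) sa fb e = to fb (to (to e (mk⇔ (λ _ → b) (λ _ → a))) (to sa a)) b
  oneFlip (yes a) (no ¬b) sa fb e = ¬b (to (from e (mk⇔ (λ _ → from fb ¬b) (λ _ → to sa a))) a)
  oneFlip (no ¬a) (yes b) sa fb e =
    ¬a (from (from e (mk⇔ (λ a′ → ⊥-elim (¬a (from sa a′))) (λ b′ → ⊥-elim (to fb b′ b)))) b)
  oneFlip (no ¬a) (no ¬b) sa fb e =
    ¬a (from sa (from (to e (mk⇔ (λ a → ⊥-elim (¬a a)) (λ b → ⊥-elim (¬b b)))) (from fb ¬b)))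

-- A ⇔ B is a parity: it is preserved exactly when both or neither of A, B flip.
parity : {A B A′ B′ : Set} → Dec A → Dec B → Dec A′ → Dec B′ → ((A ⇔ B) ⇔ (A′ ⇔ B′)) →
  ((A ⇔ A′) × (B ⇔ B′)) ⊎ ((A′ ⇔ (¬ A)) × (B′ ⇔ (¬ B)))
parity a? b? a′? b′? e with agree? a? a′? | agree? b? b′?
... | inj₁ sa | inj₁ sb = inj₁ (sa , sb)
... | inj₂ fa | inj₂ fb = inj₂ (fa , fb)
... | inj₁ sa | inj₂ fb = ⊥-elim (oneFlip a? b? sa fb e)
... | inj₂ fa | inj₁ sb =
  ⊥-elim (oneFlip b? a? sb fa (mk⇔ (λ e′ → ⇔.sym (to e (⇔.sym e′)))
                                  (λ e′ → ⇔.sym (from e (⇔.sym e′)))))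

module _ {A : Set} {_<_ : A → A → Set} where

  mkIsStrictTotalOrder : (∀ {x} → ¬ x < x) → (∀ {x y z} → x < y → y < z → x < z) →
    (∀ x y → x < y ⊎ x ≡ y ⊎ y < x) → IsStrictTotalOrder _≡_ _<_
  mkIsStrictTotalOrder irr tr connex = record
    { isStrictPartialOrder = record
      { isEquivalence = isEquivalence
      ; irrefl = λ { refl → irr }
      ; trans = tr
      ; <-resp-≈ = (λ { refl r → r }) , (λ { refl r → r }) }
    ; compare = compare }
    where
    compare : ∀ x y → Tri (x < y) (x ≡ y) (y < x)
    compare x y with connex x y
    ... | inj₁ r = tri< r (λ { refl → irr r }) (λ r′ → irr (tr r r′))
    ... | inj₂ (inj₁ refl) = tri≈ irr refl irr
    ... | inj₂ (inj₂ r) = tri> (λ r′ → irr (tr r r′)) (λ { refl → irr r }) r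

  module StrictTotalOrder (O : IsStrictTotalOrder _≡_ _<_) where
    open IsStrictTotalOrder O public using (compare; _<?_) renaming (trans to <-trans; asym to <-asym)

    irrefl : ∀ {x} → ¬ x < x
    irrefl = IsStrictTotalOrder.irrefl O refl

    <⇒≢ : ∀ {x y} → x < y → x ≢ y
    <⇒≢ r refl = irrefl r

    ≮∧≢⇒> : ∀ {x y} → ¬ x < y → x ≢ y → y < x
    ≮∧≢⇒> {x} {y} x≮y x≢y with compare x y
    ... | tri< r _ _ = ⊥-elim (x≮y r)
    ... | tri≈ _ e _ = ⊥-elim (x≢y e)
    ... | tri> _ _ r = r

    <∧≮⇒< : ∀ {x y z} → x < z → ¬ y < z → x < y
    <∧≮⇒< {x} {y} {z} x<z y≮z with compare y z
    ... | tri< r _ _ = ⊥-elim (y≮z r)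
    ... | tri≈ _ refl _ = x<z
    ... | tri> _ _ r = <-trans x<z r

    converse-⇔ : ∀ {x y u v} → x ≢ y → u ≢ v → (x < y ⇔ u < v) → (y < x ⇔ v < u)
    converse-⇔ x≢y u≢v e =
      mk⇔ (λ r → ≮∧≢⇒> (λ r′ → <-asym r (from e r′)) u≢v)
          (λ r → ≮∧≢⇒> (λ r′ → <-asym r (to e r′)) x≢y)

    <-via-pivot : ∀ {p u v} {a : Set} → Dec a → p ≢ u → p ≢ v →
      (p < v ⇔ a) → (p < u ⇔ (¬ a)) → (u < v ⇔ a)
    <-via-pivot (yes a) p≢u _ p<v p<u =
      mk⇔ (λ _ → a) (λ _ → <-trans (≮∧≢⇒> (λ r → to p<u r a) p≢u) (from p<v a))
    <-via-pivot (no ¬a) _ p≢v p<v p<u =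
      mk⇔ (λ u<v → ⊥-elim (<-asym (from p<u ¬a) (<-trans u<v (≮∧≢⇒> (λ r → ¬a (to p<v r)) p≢v))))
          (λ a → ⊥-elim (¬a a))

⊆⇒⇔ : {A : Set} {_<_ _≺_ : A → A → Set} → IsStrictTotalOrder _≡_ _<_ → IsStrictTotalOrder _≡_ _≺_ →
  (∀ {x y} → x ≺ y → x < y) → ∀ x y → (x < y ⇔ x ≺ y)
⊆⇒⇔ {_<_ = _<_} {_≺_} O O′ ≺⇒< x y = mk⇔ <⇒≺ ≺⇒<
  where
  module O = StrictTotalOrder O
  <⇒≺ : x < y → x ≺ y
  <⇒≺ x<y with StrictTotalOrder.compare O′ x y
  ... | tri< r _ _ = r
  ... | tri≈ _ refl _ = ⊥-elim (O.irrefl x<y)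
  ... | tri> _ _ r = ⊥-elim (O.<-asym x<y (≺⇒< r))

module _ {A B : Set} {_≈_ _<_ : A → A → Set} where

  isStrictTotalOrder-on : IsStrictTotalOrder _≈_ _<_ → (f : B → A) → (∀ {i j} → f i ≈ f j → i ≡ j) →
    IsStrictTotalOrder _≡_ (_<_ on f)
  isStrictTotalOrder-on O f inj = record
    { isStrictPartialOrder = record
      { isEquivalence = isEquivalence
      ; irrefl = λ { refl → O.irrefl O.Eq.refl }
      ; trans = O.trans
      ; <-resp-≈ = (λ { refl r → r }) , (λ { refl r → r }) }
    ; compare = compare }
    where
    module O = IsStrictTotalOrder O
    compare : ∀ i j → Tri (f i < f j) (i ≡ j) (f j < f i)
    compare i j with O.compare (f i) (f j)
    ... | tri< r ¬e ¬r = tri< r (λ { refl → ¬e O.Eq.refl }) ¬r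
    ... | tri≈ ¬r e ¬r′ = tri≈ ¬r (inj e) ¬r′
    ... | tri> ¬r ¬e r = tri> ¬r (λ { refl → ¬e O.Eq.refl }) r

splitAt-injective : ∀ k {m} → Injective _≡_ _≡_ (splitAt k {m})
splitAt-injective k {m} {i} {j} q =
  trans (sym (join-splitAt k m i)) (trans (cong (join k m) q) (join-splitAt k m j))

record DistinctEnumeration {A : Set} {n : ℕ} (c : Fin n → A) : Set where
  field
    size : ℕ
    elem : Fin size → A
    elem-injective : Injective _≡_ _≡_ elem
    covers : ∀ i → ∃[ j ] c i ≡ elem j
    within : ∀ j → ∃[ i ] elem j ≡ c i

enumerate : {A : Set} → (∀ (a b : A) → Dec (a ≡ b)) → ∀ {n} (c : Fin n → A) → DistinctEnumeration c
enumerate _≟_ {zero} c = record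
  { size = 0 ; elem = λ () ; elem-injective = λ { {()} } ; covers = λ () ; within = λ () }
enumerate _≟_ {suc n} c = extend (enumerate _≟_ (λ i → c (suc i)))
  where
  extend : DistinctEnumeration (λ i → c (suc i)) → DistinctEnumeration c
  extend E with any? (λ j → c zero ≟ DistinctEnumeration.elem E j)
  ... | yes (j , e) = record
    { size = size ; elem = elem ; elem-injective = elem-injective
    ; covers = λ { zero → j , e ; (suc i) → covers i }
    ; within = λ j → suc (proj₁ (within j)) , proj₂ (within j) }
    where open DistinctEnumeration E
  ... | no ∉ = record
    { size = suc size ; elem = elem′ ; elem-injective = injective
    ; covers = λ { zero → zero , refl ; (suc i) → suc (proj₁ (covers i)) , proj₂ (covers i) }
    ; within = λ { zero → zero , refl ; (suc j) → suc (proj₁ (within j)) , proj₂ (within j) } }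
    where
    open DistinctEnumeration E
    elem′ : Fin (suc size) → _
    elem′ zero = c zero
    elem′ (suc j) = elem j
    injective : Injective _≡_ _≡_ elem′
    injective {zero} {zero} _ = refl
    injective {zero} {suc j} e = ⊥-elim (∉ (j , e))
    injective {suc i} {zero} e = ⊥-elim (∉ (i , sym e))
    injective {suc i} {suc j} e = cong suc (elem-injective e)

-- Extends the order on the points e by new points, ordered among themselves by _≺_ and each
-- placed in the cut of e in which ref i lies.
module Gluing {A : Set} {_<_ : A → A → Set} (O : IsStrictTotalOrder _≡_ _<_)
  {k : ℕ} (e : Fin k → A) (e-injective : Injective _≡_ _≡_ e)
  {m : ℕ} {_≺_ : Fin m → Fin m → Set} (O′ : IsStrictTotalOrder _≡_ _≺_)
  (ref : Fin m → A) (ref≢e : ∀ i j → ref i ≢ e j)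
  (compatible : ∀ l i j → ref l < e j → e j < ref i → l ≺ i) where

  open StrictTotalOrder O
  private module O′ = StrictTotalOrder O′

  Glued : Fin k ⊎ Fin m → Fin k ⊎ Fin m → Set
  Glued (inj₁ j) (inj₁ j′) = e j < e j′
  Glued (inj₁ j) (inj₂ i) = e j < ref i
  Glued (inj₂ l) (inj₁ j) = ref l < e j
  Glued (inj₂ l) (inj₂ i) = l ≺ i

  private
    e<ref : ∀ {j l i} → e j < ref l → l ≺ i → e j < ref i
    e<ref {j} {l} {i} r p with compare (e j) (ref i)
    ... | tri< q _ _ = q
    ... | tri≈ _ q _ = ⊥-elim (ref≢e i j (sym q))
    ... | tri> _ _ q = ⊥-elim (O′.<-asym p (compatible i l j q r))

    ref<e : ∀ {l i j} → l ≺ i → ref i < e j → ref l < e j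
    ref<e {l} {i} {j} p r with compare (ref l) (e j)
    ... | tri< q _ _ = q
    ... | tri≈ _ q _ = ⊥-elim (ref≢e l j q)
    ... | tri> _ _ q = ⊥-elim (O′.<-asym p (compatible i l j r q))

    irreflexive : ∀ {s} → ¬ Glued s s
    irreflexive {inj₁ _} = irrefl
    irreflexive {inj₂ _} = O′.irrefl

    transitive : ∀ {s t u} → Glued s t → Glued t u → Glued s u
    transitive {inj₁ _} {inj₁ _} {inj₁ _} = <-trans
    transitive {inj₁ _} {inj₁ _} {inj₂ _} = <-trans
    transitive {inj₁ _} {inj₂ _} {inj₁ _} = <-trans
    transitive {inj₁ _} {inj₂ _} {inj₂ _} = e<ref
    transitive {inj₂ _} {inj₁ _} {inj₁ _} = <-trans
    transitive {inj₂ l} {inj₁ j} {inj₂ i} = compatible l i j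
    transitive {inj₂ _} {inj₂ _} {inj₁ _} = ref<e
    transitive {inj₂ _} {inj₂ _} {inj₂ _} = O′.<-trans

    connex : ∀ s t → Glued s t ⊎ s ≡ t ⊎ Glued t s
    connex (inj₁ j) (inj₁ j′) with compare (e j) (e j′)
    ... | tri< r _ _ = inj₁ r
    ... | tri≈ _ q _ = inj₂ (inj₁ (cong inj₁ (e-injective q)))
    ... | tri> _ _ r = inj₂ (inj₂ r)
    connex (inj₁ j) (inj₂ i) with compare (e j) (ref i)
    ... | tri< r _ _ = inj₁ r
    ... | tri≈ _ q _ = ⊥-elim (ref≢e i j (sym q))
    ... | tri> _ _ r = inj₂ (inj₂ r)
    connex (inj₂ l) (inj₁ j) with compare (ref l) (e j)
    ... | tri< r _ _ = inj₁ r
    ... | tri≈ _ q _ = ⊥-elim (ref≢e l j q)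
    ... | tri> _ _ r = inj₂ (inj₂ r)
    connex (inj₂ l) (inj₂ i) with O′.compare l i
    ... | tri< r _ _ = inj₁ r
    ... | tri≈ _ q _ = inj₂ (inj₁ (cong inj₂ q))
    ... | tri> _ _ r = inj₂ (inj₂ r)

  Glued-isStrictTotalOrder : IsStrictTotalOrder _≡_ Glued
  Glued-isStrictTotalOrder =
    mkIsStrictTotalOrder (λ {s} → irreflexive {s}) (λ {s} {t} {u} → transitive {s} {t} {u}) connex

module Cuts {A : Set} {_<_ : A → A → Set} (O : IsStrictTotalOrder _≡_ _<_) {n : ℕ} (c : Fin n → A) where

  open StrictTotalOrder O

  NonConstant : A → Set
  NonConstant z = ∀ k → z ≢ c k

  SameCut : A → A → Set
  SameCut z w = ∀ k → (c k < z ⇔ c k < w) × (z < c k ⇔ w < c k)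

  ConstantBetween : A → A → Set
  ConstantBetween z w = ∃[ k ] z < c k × c k < w

  SameCut-refl : ∀ {z} → SameCut z z
  SameCut-refl k = ⇔.refl , ⇔.refl

  SameCut-sym : ∀ {z w} → SameCut z w → SameCut w z
  SameCut-sym s k = ⇔.sym (proj₁ (s k)) , ⇔.sym (proj₂ (s k))

  SameCut-trans : ∀ {z w v} → SameCut z w → SameCut w v → SameCut z v
  SameCut-trans s t k = proj₁ (s k) ⟨⇔⟩ proj₁ (t k) , proj₂ (s k) ⟨⇔⟩ proj₂ (t k)

  SameCut-fromEnumeration : ∀ {z w} (E : DistinctEnumeration c) → let open DistinctEnumeration E in
    (∀ j → (elem j < z ⇔ elem j < w) × (z < elem j ⇔ w < elem j)) → SameCut z w
  SameCut-fromEnumeration {z} {w} E s k with DistinctEnumeration.covers E k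
  ... | j , c≡elem = subst (λ u → (u < z ⇔ u < w) × (z < u ⇔ w < u)) (sym c≡elem) (s j)

  SameCut-nonConstant : ∀ {z w} → NonConstant z → SameCut z w → NonConstant w
  SameCut-nonConstant {z} z∉c s k refl with compare z (c k)
  ... | tri< r _ _ = irrefl (to (proj₂ (s k)) r)
  ... | tri≈ _ e _ = z∉c k e
  ... | tri> _ _ r = irrefl (to (proj₁ (s k)) r)

  ConstantBetween⇒< : ∀ {z w} → ConstantBetween z w → z < w
  ConstantBetween⇒< (_ , z<c , c<w) = <-trans z<c c<w

  ConstantBetween-resp-SameCut : ∀ {z w z′ w′} → SameCut z z′ → SameCut w w′ →
    ConstantBetween z w → ConstantBetween z′ w′
  ConstantBetween-resp-SameCut s t (k , z<c , c<w) = k , to (proj₂ (s k)) z<c , to (proj₁ (t k)) c<w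

  SameCut⇒¬ConstantBetween : ∀ {z w} → SameCut z w → ¬ ConstantBetween z w
  SameCut⇒¬ConstantBetween s (k , z<c , c<w) = <-asym (to (proj₂ (s k)) z<c) c<w

  SameCut⊎ConstantBetween : ∀ {z w} → NonConstant z → NonConstant w →
    SameCut z w ⊎ ConstantBetween z w ⊎ ConstantBetween w z
  SameCut⊎ConstantBetween {z} {w} z∉c w∉c with all? (λ k → (c k <? z) ⇔? (c k <? w))
  ... | yes same = inj₁ λ k → same k , converse-⇔ (λ e → z∉c k (sym e)) (λ e → w∉c k (sym e)) (same k)
  ... | no ¬same with ¬∀⟶∃¬ n _ (λ k → (c k <? z) ⇔? (c k <? w)) ¬same
  ...   | k , differ with c k <? z | c k <? w
  ...     | yes c<z | yes c<w = ⊥-elim (differ (mk⇔ (λ _ → c<w) (λ _ → c<z)))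
  ...     | no c≮z  | no c≮w  = ⊥-elim (differ (mk⇔ (λ r → ⊥-elim (c≮z r)) (λ r → ⊥-elim (c≮w r))))
  ...     | yes c<z | no c≮w  = inj₂ (inj₂ (k , ≮∧≢⇒> c≮w (λ e → w∉c k (sym e)) , c<z))
  ...     | no c≮z  | yes c<w = inj₂ (inj₁ (k , ≮∧≢⇒> c≮z (λ e → z∉c k (sym e)) , c<w))

module _ {D : Set} where

  idₚ : Perm D
  idₚ = record { fwd = λ x → x ; bwd = λ x → x ; fwd∘bwd = λ _ → refl ; bwd∘fwd = λ _ → refl }

  _∘ₚ_ : Perm D → Perm D → Perm D
  p ∘ₚ q = record
    { fwd = λ x → fwd p (fwd q x)
    ; bwd = λ x → bwd q (bwd p x)
    ; fwd∘bwd = λ x → trans (cong (fwd p) (fwd∘bwd q (bwd p x))) (fwd∘bwd p x)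
    ; bwd∘fwd = λ x → trans (cong (bwd q) (bwd∘fwd p (fwd q x))) (bwd∘fwd q x) }

  _⁻¹ₚ : Perm D → Perm D
  p ⁻¹ₚ = record { fwd = bwd p ; bwd = fwd p ; fwd∘bwd = bwd∘fwd p ; bwd∘fwd = fwd∘bwd p }

  fwd-injective : (p : Perm D) → Injective _≡_ _≡_ (fwd p)
  fwd-injective p {x} {y} e = trans (sym (bwd∘fwd p x)) (trans (cong (bwd p) e) (bwd∘fwd p y))

module RandomPermutation {D : Set} {_<₁_ _<₂_ : D → D → Set} (RP : BiOrder.IsRandomPermutation _<₁_ _<₂_) where

  open BiOrder _<₁_ _<₂_ public
  open IsRandomPermutation RP public
  open IsStrictTotalOrder order₁ public using (_≟_)
  module O₁ = StrictTotalOrder order₁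
  module O₂ = StrictTotalOrder order₂

  -- SameType a b unfolds to ∀ i j → SamePairType (a i) (a j) (b i) (b j).
  SamePairType : D → D → D → D → Set
  SamePairType u v u′ v′ = (u ≡ v ⇔ u′ ≡ v′) × (u <₁ v ⇔ u′ <₁ v′) × (u <₂ v ⇔ u′ <₂ v′)

  SamePairType-refl : ∀ {u v} → SamePairType u v u v
  SamePairType-refl = ⇔.refl , ⇔.refl , ⇔.refl

  SamePairType-sym : ∀ {u v u′ v′} → SamePairType u v u′ v′ → SamePairType u′ v′ u v
  SamePairType-sym (e , r₁ , r₂) = ⇔.sym e , ⇔.sym r₁ , ⇔.sym r₂

  SamePairType-trans : ∀ {u v u′ v′ u″ v″} →
    SamePairType u v u′ v′ → SamePairType u′ v′ u″ v″ → SamePairType u v u″ v″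
  SamePairType-trans (e , r₁ , r₂) (e′ , r₁′ , r₂′) = e ⟨⇔⟩ e′ , r₁ ⟨⇔⟩ r₁′ , r₂ ⟨⇔⟩ r₂′

  SamePairType-diagonal : ∀ {u u′} → SamePairType u u u′ u′
  SamePairType-diagonal =
    mk⇔ (λ _ → refl) (λ _ → refl) ,
    mk⇔ (λ r → ⊥-elim (O₁.irrefl r)) (λ r → ⊥-elim (O₁.irrefl r)) ,
    mk⇔ (λ r → ⊥-elim (O₂.irrefl r)) (λ r → ⊥-elim (O₂.irrefl r))

  SamePairType-swap : ∀ {u v u′ v′} → SamePairType u v u′ v′ → SamePairType v u v′ u′
  SamePairType-swap {u} {v} p@(e , r₁ , r₂) with IsStrictTotalOrder._≟_ order₁ u v
  ... | yes refl with to e refl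
  ...   | refl = SamePairType-diagonal
  SamePairType-swap p@(e , r₁ , r₂) | no u≢v =
    mk⇔ (λ q → ⊥-elim (u≢v (sym q))) (λ q → ⊥-elim (u′≢v′ (sym q))) ,
    O₁.converse-⇔ u≢v u′≢v′ r₁ , O₂.converse-⇔ u≢v u′≢v′ r₂
    where u′≢v′ = λ q → u≢v (from e q)

  st⇔ : ∀ {u v} → u ≢ v → (st u v ⇔ (u <₁ v ⇔ u <₂ v))
  st⇔ {u} {v} u≢v = mk⇔ st⇒ ⇒st
    where
    st⇒ : st u v → (u <₁ v ⇔ u <₂ v)
    st⇒ (inj₁ (r₁ , r₂)) = mk⇔ (λ _ → r₂) (λ _ → r₁)
    st⇒ (inj₂ (r₁ , r₂)) = mk⇔ (λ r → ⊥-elim (O₁.<-asym r r₁)) (λ r → ⊥-elim (O₂.<-asym r r₂))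
    ⇒st : (u <₁ v ⇔ u <₂ v) → st u v
    ⇒st e with u O₁.<? v
    ... | yes r = inj₁ (r , to e r)
    ... | no ¬r = inj₂ (O₁.≮∧≢⇒> ¬r u≢v , O₂.≮∧≢⇒> (λ r → ¬r (from e r)) u≢v)

  record Embedding {I : Set} (R₁ R₂ : I → I → Set) : Set where
    field
      embed : I → D
      embed-injective : Injective _≡_ _≡_ embed
      embeds₁ : ∀ s t → (R₁ s t ⇔ embed s <₁ embed t)
      embeds₂ : ∀ s t → (R₂ s t ⇔ embed s <₂ embed t)

  universal⊎ : ∀ {k m} {R₁ R₂ : Fin k ⊎ Fin m → Fin k ⊎ Fin m → Set} →
    IsStrictTotalOrder _≡_ R₁ → IsStrictTotalOrder _≡_ R₂ → Embedding R₁ R₂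
  universal⊎ {k} {m} {R₁} {R₂} O₁′ O₂′
    with universal (R₁ on splitAt k) (R₂ on splitAt k)
           (isStrictTotalOrder-on O₁′ (splitAt k) (splitAt-injective k))
           (isStrictTotalOrder-on O₂′ (splitAt k) (splitAt-injective k))
  ... | e , e-injective , e₁ , e₂ = record
    { embed = λ s → e (join k m s)
    ; embed-injective = λ {s} {t} q →
        trans (sym (splitAt-join k m s)) (trans (cong (splitAt k) (e-injective _ _ q)) (splitAt-join k m t))
    ; embeds₁ = along {R₁} {_<₁_} e₁
    ; embeds₂ = along {R₂} {_<₂_} e₂ }
    where
    along : ∀ {R : Fin k ⊎ Fin m → Fin k ⊎ Fin m → Set} {_<_ : D → D → Set} →
      (∀ i j → (R (splitAt k i) (splitAt k j) ⇔ e i < e j)) → ∀ s t → (R s t ⇔ e (join k m s) < e (join k m t))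
    along {R} {_<_} e< s t = subst₂ (λ s′ t′ → (R s′ t′ ⇔ e (join k m s) < e (join k m t)))
      (splitAt-join k m s) (splitAt-join k m t) (e< (join k m s) (join k m t))

  module WithConstants {n : ℕ} (c : Vector D n) where

    module Cuts₁ = Cuts order₁ c
    module Cuts₂ = Cuts order₂ c
    open Cuts₁ public using (NonConstant)

    SameCuts : D → D → Set
    SameCuts z w = Cuts₁.SameCut z w × Cuts₂.SameCut z w

    SameCuts-refl : ∀ {z} → SameCuts z z
    SameCuts-refl = Cuts₁.SameCut-refl , Cuts₂.SameCut-refl

    SameCuts-sym : ∀ {z w} → SameCuts z w → SameCuts w z
    SameCuts-sym (s₁ , s₂) = Cuts₁.SameCut-sym s₁ , Cuts₂.SameCut-sym s₂

    SameCuts-trans : ∀ {z w v} → SameCuts z w → SameCuts w v → SameCuts z v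
    SameCuts-trans (s₁ , s₂) (t₁ , t₂) = Cuts₁.SameCut-trans s₁ t₁ , Cuts₂.SameCut-trans s₂ t₂

    SameCuts-nonConstant : ∀ {z w} → NonConstant z → SameCuts z w → NonConstant w
    SameCuts-nonConstant z∉c (s₁ , _) = Cuts₁.SameCut-nonConstant z∉c s₁

    SamePairType-constant : ∀ {z w} → NonConstant z → SameCuts z w → ∀ k → SamePairType z (c k) w (c k)
    SamePairType-constant z∉c s k =
      mk⇔ (λ q → ⊥-elim (z∉c k q)) (λ q → ⊥-elim (SameCuts-nonConstant z∉c s k q)) ,
      proj₂ (proj₁ s k) , proj₂ (proj₂ s k)

    SameCuts⇒Orbit : ∀ {z w} → NonConstant z → SameCuts z w → Orbit c z w
    SameCuts⇒Orbit {z} {w} z∉c s with homogeneous (z ∷ᵛ c) (w ∷ᵛ c) sameType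
      where
      sameType : SameType (z ∷ᵛ c) (w ∷ᵛ c)
      sameType zero zero = SamePairType-diagonal
      sameType zero (suc k) = SamePairType-constant z∉c s k
      sameType (suc k) zero = SamePairType-swap (SamePairType-constant z∉c s k)
      sameType (suc k) (suc l) = SamePairType-refl
    ... | α , α-aut , α-maps = α , (α-aut , λ k → α-maps (suc k)) , α-maps zero

    Orbit⇒SameCuts : ∀ {z w} → Orbit c z w → SameCuts z w
    Orbit⇒SameCuts {z} (α , ((aut₁ , aut₂) , α-fixes) , refl) =
      (λ k → moved aut₁ (c k) z (α-fixes k) refl , moved aut₁ z (c k) refl (α-fixes k)) ,
      (λ k → moved aut₂ (c k) z (α-fixes k) refl , moved aut₂ z (c k) refl (α-fixes k))
      where
      moved : ∀ {R : D → D → Set} → PreservesRel R α → ∀ u v {u′ v′} → fwd α u ≡ u′ → fwd α v ≡ v′ →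
        (R u v ⇔ R u′ v′)
      moved aut u v refl refl = aut u v

    ConstantBetween⇒Orbit<₁ : ∀ {z w z′ w′} → Cuts₁.ConstantBetween z w →
      Orbit c z z′ → Orbit c w w′ → z′ <₁ w′
    ConstantBetween⇒Orbit<₁ b oz ow = Cuts₁.ConstantBetween⇒<
      (Cuts₁.ConstantBetween-resp-SameCut (proj₁ (Orbit⇒SameCuts oz)) (proj₁ (Orbit⇒SameCuts ow)) b)

    ConstantBetween⇒Orbit<₂ : ∀ {z w z′ w′} → Cuts₂.ConstantBetween z w →
      Orbit c z z′ → Orbit c w w′ → z′ <₂ w′
    ConstantBetween⇒Orbit<₂ b oz ow = Cuts₂.ConstantBetween⇒<
      (Cuts₂.ConstantBetween-resp-SameCut (proj₂ (Orbit⇒SameCuts oz)) (proj₂ (Orbit⇒SameCuts ow)) b)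

    Infinite-Orbit⇒NonConstant : ∀ {z} → Infinite (Orbit c z) → NonConstant z
    Infinite-Orbit⇒NonConstant infinite k refl with infinite [ c k ]
    ... | w , (α , (_ , α-fixes) , refl) , ∉ = ∉ (here (α-fixes k))

    ConstantsBetween⇒DiagonalPosition : ∀ {x y} → Disjoint (Orbit c x) (Orbit c y) →
      Cuts₁.ConstantBetween x y ⊎ Cuts₁.ConstantBetween y x →
      Cuts₂.ConstantBetween x y ⊎ Cuts₂.ConstantBetween y x →
      DiagonalPosition (Orbit c x) (Orbit c y)
    ConstantsBetween⇒DiagonalPosition disjoint (inj₁ b₁) (inj₁ b₂) = disjoint , inj₁ λ _ _ ox oy →
      inj₁ (ConstantBetween⇒Orbit<₁ b₁ ox oy , ConstantBetween⇒Orbit<₂ b₂ ox oy)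
    ConstantsBetween⇒DiagonalPosition disjoint (inj₂ b₁) (inj₂ b₂) = disjoint , inj₁ λ _ _ ox oy →
      inj₂ (ConstantBetween⇒Orbit<₁ b₁ oy ox , ConstantBetween⇒Orbit<₂ b₂ oy ox)
    ConstantsBetween⇒DiagonalPosition disjoint (inj₁ b₁) (inj₂ b₂) = disjoint , inj₂ λ _ _ ox oy →
      λ { (inj₁ (_ , r₂)) → O₂.<-asym r₂ (ConstantBetween⇒Orbit<₂ b₂ oy ox)
        ; (inj₂ (r₁ , _)) → O₁.<-asym r₁ (ConstantBetween⇒Orbit<₁ b₁ ox oy) }
    ConstantsBetween⇒DiagonalPosition disjoint (inj₂ b₁) (inj₁ b₂) = disjoint , inj₂ λ _ _ ox oy →
      λ { (inj₁ (r₁ , _)) → O₁.<-asym r₁ (ConstantBetween⇒Orbit<₁ b₁ oy ox)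
        ; (inj₂ (_ , r₂)) → O₂.<-asym r₂ (ConstantBetween⇒Orbit<₂ b₂ ox oy) }

    record Realization {m : ℕ} (R₁ R₂ : Fin m → Fin m → Set) (ref : Fin m → D) : Set where
      field
        point : Fin m → D
        point-injective : Injective _≡_ _≡_ point
        realizes₁ : ∀ i j → (point i <₁ point j ⇔ R₁ i j)
        realizes₂ : ∀ i j → (point i <₂ point j ⇔ R₂ i j)
        sameCuts : ∀ i → SameCuts (ref i) (point i)

    realizes-SameType : ∀ {m} {a : Vector D m} {ref} → Injective _≡_ _≡_ a →
      (r : Realization (_<₁_ on a) (_<₂_ on a) ref) → SameType a (Realization.point r)
    realizes-SameType a-injective r i j =
      mk⇔ (λ q → cong point (a-injective q)) (λ q → cong _ (point-injective q)) ,
      ⇔.sym (realizes₁ i j) , ⇔.sym (realizes₂ i j)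
      where open Realization r

    -- Glue the requested orders to a duplicate-free list of the constants, embed the result
    -- by universality, and move the copy of the constants back onto the constants by homogeneity.
    realize : ∀ {m} {R₁ R₂ : Fin m → Fin m → Set} →
      IsStrictTotalOrder _≡_ R₁ → IsStrictTotalOrder _≡_ R₂ →
      (ref : Fin m → D) → (∀ i → NonConstant (ref i)) →
      (∀ l i k → ref l <₁ c k → c k <₁ ref i → R₁ l i) →
      (∀ l i k → ref l <₂ c k → c k <₂ ref i → R₂ l i) →
      Realization R₁ R₂ ref
    realize {m} {R₁} {R₂} O₁′ O₂′ ref ref∉c compatible₁ compatible₂ = record
      { point = point
      ; point-injective = λ q → inj₂-injective (embed-injective (fwd-injective α q))
      ; realizes₁ = λ i j → ⇔.sym (image₁ (inj₂ i) (inj₂ j))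
      ; realizes₂ = λ i j → ⇔.sym (image₂ (inj₂ i) (inj₂ j))
      ; sameCuts = λ i →
          Cuts₁.SameCut-fromEnumeration E
            (elemCut {_<₁_} {i} (λ j → image₁ (inj₁ j) (inj₂ i)) (λ j → image₁ (inj₂ i) (inj₁ j))) ,
          Cuts₂.SameCut-fromEnumeration E
            (elemCut {_<₂_} {i} (λ j → image₂ (inj₁ j) (inj₂ i)) (λ j → image₂ (inj₂ i) (inj₁ j))) }
      where
      E : DistinctEnumeration c
      E = enumerate _≟_ c
      open DistinctEnumeration E

      ref≢elem : ∀ i j → ref i ≢ elem j
      ref≢elem i j q = ref∉c i (proj₁ (within j)) (trans q (proj₂ (within j)))

      compatible-elem : ∀ {_<_ : D → D → Set} {R : Fin m → Fin m → Set} →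
        (∀ l i k → ref l < c k → c k < ref i → R l i) → ∀ l i j → ref l < elem j → elem j < ref i → R l i
      compatible-elem {_<_} {R} compatible l i j =
        subst (λ z → ref l < z → z < ref i → R l i) (sym (proj₂ (within j))) (compatible l i (proj₁ (within j)))

      module G₁ = Gluing order₁ elem elem-injective O₁′ ref ref≢elem (compatible-elem {_<₁_} compatible₁)
      module G₂ = Gluing order₂ elem elem-injective O₂′ ref ref≢elem (compatible-elem {_<₂_} compatible₂)

      U : Embedding G₁.Glued G₂.Glued
      U = universal⊎ G₁.Glued-isStrictTotalOrder G₂.Glued-isStrictTotalOrder
      open Embedding U

      elems-SameType : SameType (λ j → embed (inj₁ j)) elem
      elems-SameType i j =
        mk⇔ (λ q → cong elem (inj₁-injective (embed-injective q)))
            (λ q → cong (λ j → embed (inj₁ j)) (elem-injective q)) ,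
        ⇔.sym (embeds₁ (inj₁ i) (inj₁ j)) , ⇔.sym (embeds₂ (inj₁ i) (inj₁ j))

      H : Σ (Perm D) λ α → IsAut α × (∀ j → fwd α (embed (inj₁ j)) ≡ elem j)
      H = homogeneous (λ j → embed (inj₁ j)) elem elems-SameType
      α : Perm D
      α = proj₁ H
      α-aut : IsAut α
      α-aut = proj₁ (proj₂ H)
      α-maps : ∀ j → fwd α (embed (inj₁ j)) ≡ elem j
      α-maps = proj₂ (proj₂ H)

      image : Fin size ⊎ Fin m → D
      image s = fwd α (embed s)

      point : Fin m → D
      point i = image (inj₂ i)

      image₁ : ∀ s t → (G₁.Glued s t ⇔ image s <₁ image t)
      image₁ s t = embeds₁ s t ⟨⇔⟩ proj₁ α-aut (embed s) (embed t)

      image₂ : ∀ s t → (G₂.Glued s t ⇔ image s <₂ image t)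
      image₂ s t = embeds₂ s t ⟨⇔⟩ proj₂ α-aut (embed s) (embed t)

      elemCut : ∀ {_<_ : D → D → Set} {i} →
        (∀ j → (elem j < ref i ⇔ image (inj₁ j) < point i)) →
        (∀ j → (ref i < elem j ⇔ point i < image (inj₁ j))) →
        ∀ j → (elem j < ref i ⇔ elem j < point i) × (ref i < elem j ⇔ point i < elem j)
      elemCut {_<_} {i} below above j =
        subst (λ z → (elem j < ref i ⇔ z < point i)) (α-maps j) (below j) ,
        subst (λ z → (ref i < elem j ⇔ point i < z)) (α-maps j) (above j)

module Generation {D : Set} {_<₁_ _<₂_ : D → D → Set} (RP : BiOrder.IsRandomPermutation _<₁_ _<₂_)
  {n : ℕ} (c : Vector D n)
  (G : Perm D → Set) (G-closed : IsClosedPermGroup G) (Aut⊆G : ∀ p → BiOrder.IsAut _<₁_ _<₂_ p → G p)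
  (g : D → D) (g-generated : MonGenerated G g) (g-canonical : BiOrder.Canonical _<₁_ _<₂_ c g) where

  open RandomPermutation RP
  open WithConstants c
  open IsPermGroup (proj₁ G-closed)

  G-idₚ : G idₚ
  G-idₚ = id∈ idₚ (λ _ → refl)

  G-∘ₚ : ∀ {p q} → G p → G q → G (p ∘ₚ q)
  G-∘ₚ {p} {q} p∈G q∈G = comp∈ p q (p ∘ₚ q) p∈G q∈G (λ _ → refl)

  G-⁻¹ₚ : ∀ {p} → G p → G (p ⁻¹ₚ)
  G-⁻¹ₚ {p} p∈G = inv∈ p (p ⁻¹ₚ) p∈G (λ _ → refl)

  composeₚ : List (Perm D) → Perm D
  composeₚ [] = idₚ
  composeₚ (p ∷ ps) = p ∘ₚ composeₚ ps

  fwd-composeₚ : ∀ ps x → fwd (composeₚ ps) x ≡ composeAll ps x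
  fwd-composeₚ [] x = refl
  fwd-composeₚ (p ∷ ps) x = cong (fwd p) (fwd-composeₚ ps x)

  G-composeₚ : ∀ {ps} → All G ps → G (composeₚ ps)
  G-composeₚ [] = G-idₚ
  G-composeₚ (p∈G ∷ ps∈G) = G-∘ₚ p∈G (G-composeₚ ps∈G)

  infix 4 _~_
  _~_ : ∀ {m} → Vector D m → Vector D m → Set
  a ~ b = Σ (Perm D) λ σ → G σ × (∀ i → fwd σ (a i) ≡ b i)

  ~-refl : ∀ {m} {a : Vector D m} → a ~ a
  ~-refl = idₚ , G-idₚ , λ _ → refl

  ~-sym : ∀ {m} {a b : Vector D m} → a ~ b → b ~ a
  ~-sym {a = a} (σ , σ∈G , σa≡b) =
    σ ⁻¹ₚ , G-⁻¹ₚ σ∈G , λ i → trans (cong (bwd σ) (sym (σa≡b i))) (bwd∘fwd σ (a i))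

  ~-trans : ∀ {m} {a b d : Vector D m} → a ~ b → b ~ d → a ~ d
  ~-trans (σ , σ∈G , σa≡b) (τ , τ∈G , τb≡d) =
    τ ∘ₚ σ , G-∘ₚ τ∈G σ∈G , λ i → trans (cong (fwd τ) (σa≡b i)) (τb≡d i)

  SameType⇒~ : ∀ {m} {a b : Vector D m} → SameType a b → a ~ b
  SameType⇒~ {a = a} {b} same with homogeneous a b same
  ... | α , α-aut , α-maps = α , Aut⊆G α α-aut , α-maps

  g-injective : Injective _≡_ _≡_ g
  g-injective {u} {v} gu≡gv with g-generated (u ∷ v ∷ [])
  ... | ps , _ , (hu≡gu ∷ hv≡gv ∷ []) = composeAll-injective ps (trans hu≡gu (trans gu≡gv (sym hv≡gv)))
    where
    composeAll-injective : ∀ ps → Injective _≡_ _≡_ (composeAll ps)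
    composeAll-injective [] q = q
    composeAll-injective (p ∷ ps) q = composeAll-injective ps (fwd-injective p q)

  -- g agrees with some h ∈ G on a and b, and h(a) and h(b) are related by an automorphism.
  SameType-g⇒~ : ∀ {m} (a b : Vector D m) → SameType (λ i → g (a i)) (λ i → g (b i)) → a ~ b
  SameType-g⇒~ {m} a b same with g-generated (tabulate a ++ tabulate b) | homogeneous _ _ same
  ... | ps , ps∈G , h≡g | α , α-aut , α-maps =
    (h ⁻¹ₚ) ∘ₚ (α ∘ₚ h) , G-∘ₚ (G-⁻¹ₚ h∈G) (G-∘ₚ (Aut⊆G α α-aut) h∈G) , maps
    where
    h : Perm D
    h = composeₚ ps
    h∈G : G h
    h∈G = G-composeₚ ps∈G
    h≡g-on : ∀ (d : Vector D m) → All (λ x → composeAll ps x ≡ g x) (tabulate d) →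
      ∀ i → fwd h (d i) ≡ g (d i)
    h≡g-on d agree i = trans (fwd-composeₚ ps (d i)) (All.tabulate⁻ agree i)
    maps : ∀ i → bwd h (fwd α (fwd h (a i))) ≡ b i
    maps i = begin
      bwd h (fwd α (fwd h (a i)))  ≡⟨ cong (λ z → bwd h (fwd α z)) (h≡g-on a (All.++⁻ˡ (tabulate a) h≡g) i) ⟩
      bwd h (fwd α (g (a i)))      ≡⟨ cong (bwd h) (α-maps i) ⟩
      bwd h (g (b i))              ≡⟨ cong (bwd h) (sym (h≡g-on b (All.++⁻ʳ (tabulate a) h≡g) i)) ⟩
      bwd h (fwd h (b i))          ≡⟨ bwd∘fwd h (b i) ⟩
      b i                          ∎
      where open ≡-Reasoning

  Aut⊆G-fromTypes : (R : D → D → Set) →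
    (∀ {m} (a b : Vector D m) → Injective _≡_ _≡_ a → Injective _≡_ _≡_ b →
      (∀ i j → (R (a i) (a j) ⇔ R (b i) (b j))) → a ~ b) →
    ∀ p → PreservesRel R p → G p
  Aut⊆G-fromTypes R related p p-preserves = proj₂ G-closed p λ A → approximate A (enumerate _≟_ (lookup A))
    where
    approximate : (A : List D) → DistinctEnumeration (lookup A) → Σ (Perm D) λ h → G h × AgreeOn (fwd h) (fwd p) A
    approximate A E = σ , σ∈G , All.tabulate agree
      where
      open DistinctEnumeration E
      p-elem : Vector D size
      p-elem j = fwd p (elem j)
      σ~ : elem ~ p-elem
      σ~ = related elem p-elem elem-injective (λ q → elem-injective (fwd-injective p q))
             (λ i j → p-preserves (elem i) (elem j))
      σ : Perm D
      σ = proj₁ σ~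
      σ∈G : G σ
      σ∈G = proj₁ (proj₂ σ~)
      σ-maps : ∀ j → fwd σ (elem j) ≡ fwd p (elem j)
      σ-maps = proj₂ (proj₂ σ~)
      agree : ∀ {x} → x ∈ A → fwd σ x ≡ fwd p x
      agree x∈A = let j , lookup≡elem = covers (Any.index x∈A) in
        subst (λ z → fwd σ z ≡ fwd p z) (sym (trans (lookup-index x∈A) lookup≡elem)) (σ-maps j)

  Diagonalized : D → D → Set
  Diagonalized x y = ∀ {u v u′ v′} → SameCuts x u → SameCuts y v → SameCuts x u′ → SameCuts y v′ →
    st (g u) (g v) → st (g u′) (g v′)

  Diagonalized-sym : ∀ {x y} → Diagonalized x y → Diagonalized y x
  Diagonalized-sym d su sv su′ sv′ s = ⊎.swap (d sv su sv′ su′ (⊎.swap s))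

  Diagonalizes⇒Diagonalized : ∀ {x y} → NonConstant x → NonConstant y →
    Diagonalizes g (Orbit c x) (Orbit c y) → Diagonalized x y
  Diagonalizes⇒Diagonalized x∉c y∉c (_ , inj₁ all-st) _ _ su′ sv′ _ =
    all-st _ _ (_ , SameCuts⇒Orbit x∉c su′ , refl) (_ , SameCuts⇒Orbit y∉c sv′ , refl)
  Diagonalizes⇒Diagonalized x∉c y∉c (_ , inj₂ all-tw) su sv _ _ s =
    ⊥-elim (all-tw _ _ (_ , SameCuts⇒Orbit x∉c su , refl) (_ , SameCuts⇒Orbit y∉c sv , refl) s)

  g-SamePairType : ∀ {u v u′ v′} → NonConstant u → NonConstant v → SameCuts u u′ → SameCuts v v′ →
    SamePairType u v u′ v′ → SamePairType (g u) (g v) (g u′) (g v′)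
  g-SamePairType {u} {v} {u′} {v′} u∉c v∉c su sv p =
    g-canonical (u ∷ᵛ v ∷ᵛ []ᵛ) (u′ ∷ᵛ v′ ∷ᵛ []ᵛ) sameType zero (suc zero)
    where
    sameType : SameTypeC c (u ∷ᵛ v ∷ᵛ []ᵛ) (u′ ∷ᵛ v′ ∷ᵛ []ᵛ)
    sameType zero zero = SamePairType-diagonal
    sameType zero (suc zero) = p
    sameType (suc zero) zero = SamePairType-swap p
    sameType (suc zero) (suc zero) = SamePairType-diagonal
    sameType zero (suc (suc k)) = SamePairType-constant u∉c su k
    sameType (suc zero) (suc (suc k)) = SamePairType-constant v∉c sv k
    sameType (suc (suc k)) zero = SamePairType-swap (SamePairType-constant u∉c su k)
    sameType (suc (suc k)) (suc zero) = SamePairType-swap (SamePairType-constant v∉c sv k)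
    sameType (suc (suc k)) (suc (suc l)) = SamePairType-refl

  g-SamePairType-inOrbit : ∀ {z u v u′ v′} → NonConstant z →
    SameCuts z u → SameCuts z v → SameCuts z u′ → SameCuts z v′ →
    SamePairType u v u′ v′ → SamePairType (g u) (g v) (g u′) (g v′)
  g-SamePairType-inOrbit z∉c su sv su′ sv′ =
    g-SamePairType (SameCuts-nonConstant z∉c su) (SameCuts-nonConstant z∉c sv)
      (SameCuts-trans (SameCuts-sym su) su′) (SameCuts-trans (SameCuts-sym sv) sv′)

  module Split (x y : D) (x∉c : NonConstant x) (y∉c : NonConstant y)
    (cut₁ : Cuts₁.SameCut x y) (between₂ : Cuts₂.ConstantBetween x y) (diagonalized : Diagonalized x y) where

    X<₂Y : ∀ {u v} → SameCuts x u → SameCuts y v → u <₂ v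
    X<₂Y (_ , su) (_ , sv) = Cuts₂.ConstantBetween⇒< (Cuts₂.ConstantBetween-resp-SameCut su sv between₂)

    side : {P : Set} → Dec P → D
    side (yes _) = x
    side (no _) = y

    realizeSplit : ∀ {m} {R₁ R₂ : Fin m → Fin m → Set} →
      IsStrictTotalOrder _≡_ R₁ → IsStrictTotalOrder _≡_ R₂ →
      {Lower : Fin m → Set} (lower? : ∀ i → Dec (Lower i)) → (∀ l i → Lower l → ¬ Lower i → R₂ l i) →
      Realization R₁ R₂ (λ i → side (lower? i))
    realizeSplit O₁′ O₂′ lower? compatible = realize O₁′ O₂′ _ side∉c compatible₁ compatible₂
      where
      side∉c : ∀ i → NonConstant (side (lower? i))
      side∉c i with lower? i
      ... | yes _ = x∉c
      ... | no _ = y∉c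
      cut₁-side : ∀ i → Cuts₁.SameCut x (side (lower? i))
      cut₁-side i with lower? i
      ... | yes _ = Cuts₁.SameCut-refl
      ... | no _ = cut₁
      compatible₁ : ∀ l i k → side (lower? l) <₁ c k → c k <₁ side (lower? i) → _
      compatible₁ l i k r s = ⊥-elim (Cuts₁.SameCut⇒¬ConstantBetween
        (Cuts₁.SameCut-trans (Cuts₁.SameCut-sym (cut₁-side l)) (cut₁-side i)) (k , r , s))
      compatible₂ : ∀ l i k → side (lower? l) <₂ c k → c k <₂ side (lower? i) → _
      compatible₂ l i k r s with lower? l | lower? i
      ... | yes L | no ¬L = compatible l i L ¬L
      ... | yes _ | yes _ = ⊥-elim (Cuts₂.SameCut⇒¬ConstantBetween Cuts₂.SameCut-refl (k , r , s))
      ... | no _  | no _  = ⊥-elim (Cuts₂.SameCut⇒¬ConstantBetween Cuts₂.SameCut-refl (k , r , s))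
      ... | no _  | yes _ = ⊥-elim (O₂.<-asym (X<₂Y SameCuts-refl SameCuts-refl) (O₂.<-trans r s))

    module _ {m} {R₁ R₂ : Fin m → Fin m → Set} {Lower : Fin m → Set} {lower? : ∀ i → Dec (Lower i)}
      (r : Realization R₁ R₂ (λ i → side (lower? i))) where
      open Realization r

      inX : ∀ {i} → Lower i → SameCuts x (point i)
      inX {i} L with lower? i | sameCuts i
      ... | yes _ | s = s
      ... | no ¬L | _ = ⊥-elim (¬L L)

      inY : ∀ {i} → ¬ Lower i → SameCuts y (point i)
      inY {i} ¬L with lower? i | sameCuts i
      ... | yes L | _ = ⊥-elim (¬L L)
      ... | no _  | s = s

    crossRealization : ∀ {R₁ : Fin 2 → Fin 2 → Set} → IsStrictTotalOrder _≡_ R₁ →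
      Realization R₁ _<ᶠ_ (λ i → side (i ≟ᶠ zero))
    crossRealization O = realizeSplit O Fin.<-isStrictTotalOrder (_≟ᶠ zero) compatible
      where
      compatible : ∀ l i → l ≡ zero → i ≢ zero → l <ᶠ i
      compatible zero zero _ i≢0 = ⊥-elim (i≢0 refl)
      compatible zero (suc zero) _ _ = z<s

    P₀ : Realization _<ᶠ_ _<ᶠ_ (λ i → side (i ≟ᶠ zero))
    P₀ = crossRealization Fin.<-isStrictTotalOrder
    P₁ : Realization (λ i j → j <ᶠ i) _<ᶠ_ (λ i → side (i ≟ᶠ zero))
    P₁ = crossRealization (isStrictTotalOrder-on (Flip.isStrictTotalOrder Fin.<-isStrictTotalOrder) (λ i → i) sym)

    x₀ y₀ x₁ y₁ : D
    x₀ = Realization.point P₀ zero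
    y₀ = Realization.point P₀ (suc zero)
    x₁ = Realization.point P₁ zero
    y₁ = Realization.point P₁ (suc zero)

    x₀∈X : SameCuts x x₀
    x₀∈X = inX P₀ refl
    y₀∈Y : SameCuts y y₀
    y₀∈Y = inY P₀ λ ()
    x₁∈X : SameCuts x x₁
    x₁∈X = inX P₁ refl
    y₁∈Y : SameCuts y y₁
    y₁∈Y = inY P₁ λ ()

    x₀<₁y₀ : x₀ <₁ y₀
    x₀<₁y₀ = from (Realization.realizes₁ P₀ zero (suc zero)) z<s
    y₁<₁x₁ : y₁ <₁ x₁
    y₁<₁x₁ = from (Realization.realizes₁ P₁ (suc zero) zero) z<s

    g-X≢Y : ∀ {u v} → SameCuts x u → SameCuts y v → g u ≢ g v
    g-X≢Y su sv q = O₂.<⇒≢ (X<₂Y su sv) (g-injective q)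

    cross-SamePairType : ∀ {u v u′ v′} → SameCuts x u → SameCuts y v → SameCuts x u′ → SameCuts y v′ →
      (u <₁ v ⇔ u′ <₁ v′) → SamePairType (g u) (g v) (g u′) (g v′)
    cross-SamePairType su sv su′ sv′ r₁ =
      g-SamePairType (SameCuts-nonConstant x∉c su) (SameCuts-nonConstant y∉c sv)
        (SameCuts-trans (SameCuts-sym su) su′) (SameCuts-trans (SameCuts-sym sv) sv′)
        ( mk⇔ (λ q → ⊥-elim (O₂.<⇒≢ (X<₂Y su sv) q)) (λ q → ⊥-elim (O₂.<⇒≢ (X<₂Y su′ sv′) q))
        , r₁
        , mk⇔ (λ _ → X<₂Y su′ sv′) (λ _ → X<₂Y su sv) )

    A₀ B₀ A₁ B₁ : Set
    A₀ = g x₀ <₁ g y₀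
    B₀ = g x₀ <₂ g y₀
    A₁ = g x₁ <₁ g y₁
    B₁ = g x₁ <₂ g y₁

    st-agrees : (A₀ ⇔ B₀) ⇔ (A₁ ⇔ B₁)
    st-agrees =
      ⇔.sym (st⇔ (g-X≢Y x₀∈X y₀∈Y)) ⟨⇔⟩
      mk⇔ (diagonalized x₀∈X y₀∈Y x₁∈X y₁∈Y) (diagonalized x₁∈X y₁∈Y x₀∈X y₀∈Y) ⟨⇔⟩
      st⇔ (g-X≢Y x₁∈X y₁∈Y)

    SortedAt : ∀ {m} → Vector D m → Fin m → Set
    SortedAt b t = ∀ i → b i <₂ b t → b i <₁ b t

    record SortedCopy {m} (a : Vector D m) (ts : List (Fin m)) : Set where
      field
        sorted : Vector D m
        sorted-injective : Injective _≡_ _≡_ sorted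
        related : a ~ sorted
        same₂ : ∀ i j → (sorted i <₂ sorted j ⇔ a i <₂ a j)
        sortedAt : All (SortedAt sorted) ts

    module Preserving (keeps₁ : A₀ ⇔ A₁) (keeps₂ : B₀ ⇔ B₁) where

      cross-uniform : ∀ {u v u′ v′} → SameCuts x u → SameCuts y v → SameCuts x u′ → SameCuts y v′ →
        SamePairType (g u) (g v) (g u′) (g v′)
      cross-uniform su sv su′ sv′ = SamePairType-trans (toBase su sv) (SamePairType-sym (toBase su′ sv′))
        where
        base : SamePairType (g x₀) (g y₀) (g x₁) (g y₁)
        base = mk⇔ (λ q → ⊥-elim (g-X≢Y x₀∈X y₀∈Y q)) (λ q → ⊥-elim (g-X≢Y x₁∈X y₁∈Y q)) ,
               keeps₁ , keeps₂
        toBase′ : ∀ {u v} → SameCuts x u → SameCuts y v → Tri (u <₁ v) (u ≡ v) (v <₁ u) →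
          SamePairType (g u) (g v) (g x₀) (g y₀)
        toBase′ su sv (tri< u<v _ _) =
          cross-SamePairType su sv x₀∈X y₀∈Y (mk⇔ (λ _ → x₀<₁y₀) (λ _ → u<v))
        toBase′ su sv (tri≈ _ u≡v _) = ⊥-elim (O₂.<⇒≢ (X<₂Y su sv) u≡v)
        toBase′ su sv (tri> _ _ v<u) = SamePairType-trans
          (cross-SamePairType su sv x₁∈X y₁∈Y
            (mk⇔ (λ r → ⊥-elim (O₁.<-asym r v<u)) (λ r → ⊥-elim (O₁.<-asym r y₁<₁x₁))))
          (SamePairType-sym base)
        toBase : ∀ {u v} → SameCuts x u → SameCuts y v → SamePairType (g u) (g v) (g x₀) (g y₀)
        toBase {u} {v} su sv = toBase′ su sv (O₁.compare u v)

      -- Copy a with the points <₂-below a t into X and the others into Y, once faithfully (p) and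
      -- once with the lower points moved <₁-below the upper ones (b); g cannot tell p from b.
      module Step {m} (a : Vector D m) (a-injective : Injective _≡_ _≡_ a) (t : Fin m) where

        lower? : ∀ i → Dec (a i <₂ a t)
        lower? i = a i O₂.<? a t

        key : Fin m → Bool
        key i = not (does (lower? i))

        key-lower : ∀ {i} → a i <₂ a t → key i ≡ false
        key-lower {i} r = cong not (dec-true (lower? i) r)

        key-upper : ∀ {i} → ¬ a i <₂ a t → key i ≡ true
        key-upper {i} ¬r = cong not (dec-false (lower? i) ¬r)

        _◁_ : Fin m → Fin m → Set
        i ◁ j = ×-Lex _≡_ Bool._<_ (_<₁_ on a) (key i , i) (key j , j)

        ◁-isStrictTotalOrder : IsStrictTotalOrder _≡_ _◁_
        ◁-isStrictTotalOrder = isStrictTotalOrder-on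
          (×-isStrictTotalOrder Bool.<-isStrictTotalOrder (isStrictTotalOrder-on order₁ a a-injective))
          (λ i → key i , i) proj₂

        ◁-sameSide : ∀ {i j} → key i ≡ key j → (i ◁ j ⇔ a i <₁ a j)
        ◁-sameSide q =
          mk⇔ (λ { (inj₁ k<k) → ⊥-elim (Bool.<-irrefl q k<k) ; (inj₂ (_ , r)) → r }) (λ r → inj₂ (q , r))

        ◁-cross : ∀ {i j} → a i <₂ a t → ¬ a j <₂ a t → i ◁ j
        ◁-cross ri ¬rj = inj₁ (subst₂ Bool._<_ (sym (key-lower ri)) (sym (key-upper ¬rj)) Bool.f<t)

        P : Realization (_<₁_ on a) (_<₂_ on a) (λ i → side (lower? i))
        P = realizeSplit (isStrictTotalOrder-on order₁ a a-injective) (isStrictTotalOrder-on order₂ a a-injective)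
          lower? (λ _ _ → O₂.<∧≮⇒<)
        B : Realization _◁_ (_<₂_ on a) (λ i → side (lower? i))
        B = realizeSplit ◁-isStrictTotalOrder (isStrictTotalOrder-on order₂ a a-injective)
          lower? (λ _ _ → O₂.<∧≮⇒<)
        p b : Vector D m
        p = Realization.point P
        b = Realization.point B
        b-injective : Injective _≡_ _≡_ b
        b-injective = Realization.point-injective B
        b-realizes₁ : ∀ i j → (b i <₁ b j ⇔ i ◁ j)
        b-realizes₁ = Realization.realizes₁ B
        b-realizes₂ : ∀ i j → (b i <₂ b j ⇔ a i <₂ a j)
        b-realizes₂ = Realization.realizes₂ B

        b-cross : ∀ {i j} → a i <₂ a t → ¬ a j <₂ a t → b i <₁ b j
        b-cross ri ¬rj = from (b-realizes₁ _ _) (◁-cross ri ¬rj)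

        b-sameSide : ∀ {i j} → key i ≡ key j → (b i <₁ b j ⇔ a i <₁ a j)
        b-sameSide q = b-realizes₁ _ _ ⟨⇔⟩ ◁-sameSide q

        sameSide-pair : ∀ {i j} → i ≢ j → key i ≡ key j → SamePairType (p i) (p j) (b i) (b j)
        sameSide-pair i≢j q =
          mk⇔ (λ e → ⊥-elim (i≢j (Realization.point-injective P e))) (λ e → ⊥-elim (i≢j (b-injective e))) ,
          Realization.realizes₁ P _ _ ⟨⇔⟩ ⇔.sym (b-sameSide q) ,
          Realization.realizes₂ P _ _ ⟨⇔⟩ ⇔.sym (b-realizes₂ _ _)

        image′ : ∀ i j → Dec (i ≡ j) → Dec (a i <₂ a t) → Dec (a j <₂ a t) →
          SamePairType (g (p i)) (g (p j)) (g (b i)) (g (b j))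
        image′ i _ (yes refl) _ _ = SamePairType-diagonal
        image′ i j (no i≢j) (yes ri) (yes rj) =
          g-SamePairType-inOrbit x∉c (inX P ri) (inX P rj) (inX B ri) (inX B rj)
            (sameSide-pair i≢j (trans (key-lower ri) (sym (key-lower rj))))
        image′ i j (no i≢j) (no ¬ri) (no ¬rj) =
          g-SamePairType-inOrbit y∉c (inY P ¬ri) (inY P ¬rj) (inY B ¬ri) (inY B ¬rj)
            (sameSide-pair i≢j (trans (key-upper ¬ri) (sym (key-upper ¬rj))))
        image′ i j (no _) (yes ri) (no ¬rj) = cross-uniform (inX P ri) (inY P ¬rj) (inX B ri) (inY B ¬rj)
        image′ i j (no _) (no ¬ri) (yes rj) =
          SamePairType-swap (cross-uniform (inX P rj) (inY P ¬ri) (inX B rj) (inY B ¬ri))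

        a~b : a ~ b
        a~b = ~-trans (SameType⇒~ (realizes-SameType a-injective P))
          (SameType-g⇒~ p b λ i j → image′ i j (i ≟ᶠ j) (lower? i) (lower? j))

        sortedAt-t : SortedAt b t
        sortedAt-t i bi<bt = b-cross (to (b-realizes₂ i t) bi<bt) O₂.irrefl

        preserves′ : ∀ t′ → SortedAt a t′ → ∀ i → a i <₂ a t′ → Dec (a i <₂ a t) → Dec (a t′ <₂ a t) →
          b i <₁ b t′
        preserves′ t′ sorted i ai<at′ (yes ri) (yes rt′) =
          from (b-sameSide (trans (key-lower ri) (sym (key-lower rt′)))) (sorted i ai<at′)
        preserves′ t′ sorted i ai<at′ (no ¬ri) (no ¬rt′) =
          from (b-sameSide (trans (key-upper ¬ri) (sym (key-upper ¬rt′)))) (sorted i ai<at′)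
        preserves′ t′ _ i _ (yes ri) (no ¬rt′) = b-cross ri ¬rt′
        preserves′ t′ _ i ai<at′ (no ¬ri) (yes rt′) = ⊥-elim (¬ri (O₂.<-trans ai<at′ rt′))

        preserves : ∀ {t′} → SortedAt a t′ → SortedAt b t′
        preserves {t′} sorted i bi<bt′ =
          preserves′ t′ sorted i (to (b-realizes₂ i t′) bi<bt′) (lower? i) (lower? t′)

      sortCopy : ∀ {m} (a : Vector D m) → Injective _≡_ _≡_ a → (ts : List (Fin m)) → SortedCopy a ts
      sortCopy a a-injective [] = record
        { sorted = a ; sorted-injective = a-injective ; related = ~-refl ; same₂ = λ _ _ → ⇔.refl ; sortedAt = [] }
      sortCopy a a-injective (t ∷ ts) = record
        { sorted = b
        ; sorted-injective = b-injective
        ; related = ~-trans related a~b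
        ; same₂ = λ i j → b-realizes₂ i j ⟨⇔⟩ same₂ i j
        ; sortedAt = sortedAt-t ∷ All.map preserves sortedAt }
        where
        open SortedCopy (sortCopy a a-injective ts)
        open Step sorted sorted-injective t

      sorted-orders-agree : ∀ {m} {a : Vector D m} (sc : SortedCopy a (allFin m)) →
        let b = SortedCopy.sorted sc in ∀ i j → (b i <₁ b j ⇔ b i <₂ b j)
      sorted-orders-agree sc = ⊆⇒⇔ (isStrictTotalOrder-on order₁ sorted sorted-injective)
        (isStrictTotalOrder-on order₂ sorted sorted-injective)
        (λ {i} {j} r → All.lookup sortedAt (∈-allFin j) i r)
        where open SortedCopy sc

      Aut₂⊆G : ∀ p → IsAut₂ p → G p
      Aut₂⊆G = Aut⊆G-fromTypes _<₂_ related
        where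
        related : ∀ {m} (a b : Vector D m) → Injective _≡_ _≡_ a → Injective _≡_ _≡_ b →
          (∀ i j → (a i <₂ a j ⇔ b i <₂ b j)) → a ~ b
        related {m} a b a-injective b-injective same =
          ~-trans (SortedCopy.related A) (~-trans (SameType⇒~ sameType) (~-sym (SortedCopy.related B)))
          where
          A : SortedCopy a (allFin m)
          A = sortCopy a a-injective (allFin m)
          B : SortedCopy b (allFin m)
          B = sortCopy b b-injective (allFin m)
          a′ b′ : Vector D m
          a′ = SortedCopy.sorted A
          b′ = SortedCopy.sorted B
          same₂′ : ∀ i j → (a′ i <₂ a′ j ⇔ b′ i <₂ b′ j)
          same₂′ i j = SortedCopy.same₂ A i j ⟨⇔⟩ same i j ⟨⇔⟩ ⇔.sym (SortedCopy.same₂ B i j)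
          sameType : SameType a′ b′
          sameType i j =
            mk⇔ (λ q → cong b′ (SortedCopy.sorted-injective A q))
                (λ q → cong a′ (SortedCopy.sorted-injective B q)) ,
            sorted-orders-agree A i j ⟨⇔⟩ same₂′ i j ⟨⇔⟩ ⇔.sym (sorted-orders-agree B i j) ,
            same₂′ i j

    module Flipping (flip₁ : A₁ ⇔ (¬ A₀)) (flip₂ : B₁ ⇔ (¬ B₀)) where

      -- A point x′ of X placed <₁-between copies u₀, v₀ of u and v relates to v₀ as x₀ to y₀
      -- and to u₀ as x₁ to y₁, i.e. oppositely under g; so g u₀, g v₀ are ordered like g x₀, g y₀.
      module Pivot {u v} (su : SameCuts y u) (sv : SameCuts y v) (u<v : u <₁ v) where

        x<u : x <₂ u
        x<u = X<₂Y SameCuts-refl su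
        x<v : x <₂ v
        x<v = X<₂Y SameCuts-refl sv

        w : Vector D 3
        w = u ∷ᵛ x ∷ᵛ v ∷ᵛ []ᵛ

        w-injective : Injective _≡_ _≡_ w
        w-injective {zero} {zero} _ = refl
        w-injective {zero} {suc zero} q = ⊥-elim (O₂.<⇒≢ x<u (sym q))
        w-injective {zero} {suc (suc zero)} q = ⊥-elim (O₁.<⇒≢ u<v q)
        w-injective {suc zero} {zero} q = ⊥-elim (O₂.<⇒≢ x<u q)
        w-injective {suc zero} {suc zero} _ = refl
        w-injective {suc zero} {suc (suc zero)} q = ⊥-elim (O₂.<⇒≢ x<v q)
        w-injective {suc (suc zero)} {zero} q = ⊥-elim (O₁.<⇒≢ u<v (sym q))
        w-injective {suc (suc zero)} {suc zero} q = ⊥-elim (O₂.<⇒≢ x<v (sym q))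
        w-injective {suc (suc zero)} {suc (suc zero)} _ = refl

        compatible : ∀ l i → l ≡ suc zero → i ≢ suc zero → w l <₂ w i
        compatible (suc zero) zero _ _ = x<u
        compatible (suc zero) (suc zero) _ i≢1 = ⊥-elim (i≢1 refl)
        compatible (suc zero) (suc (suc zero)) _ _ = x<v

        T : Realization _<ᶠ_ (_<₂_ on w) (λ i → side (i ≟ᶠ suc zero))
        T = realizeSplit Fin.<-isStrictTotalOrder (isStrictTotalOrder-on order₂ w w-injective)
              (_≟ᶠ suc zero) compatible
        open Realization T

        u₀ x′ v₀ : D
        u₀ = point zero
        x′ = point (suc zero)
        v₀ = point (suc (suc zero))

        g-x′≢ : ∀ {i} → suc zero ≢ i → g x′ ≢ g (point i)
        g-x′≢ 1≢i q = 1≢i (point-injective (g-injective q))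

        copy : SamePairType (g u₀) (g v₀) (g u) (g v)
        copy = g-SamePairType-inOrbit y∉c (inY T λ ()) (inY T λ ()) su sv
          ( mk⇔ (λ q → ⊥-elim (0≢2 (point-injective q))) (λ q → ⊥-elim (O₁.<⇒≢ u<v q))
          , mk⇔ (λ _ → u<v) (λ _ → from (realizes₁ zero (suc (suc zero))) z<s)
          , realizes₂ zero (suc (suc zero)) )
          where
          0≢2 : _≢_ {A = Fin 3} zero (suc (suc zero))
          0≢2 ()

        above : SamePairType (g x′) (g v₀) (g x₀) (g y₀)
        above = cross-SamePairType (inX T refl) (inY T λ ()) x₀∈X y₀∈Y
          (mk⇔ (λ _ → x₀<₁y₀) (λ _ → from (realizes₁ (suc zero) (suc (suc zero))) (s<s z<s)))

        below : SamePairType (g x′) (g u₀) (g x₁) (g y₁)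
        below = cross-SamePairType (inX T refl) (inY T λ ()) x₁∈X y₁∈Y
          (mk⇔ (λ r → ⊥-elim (1≮0 (to (realizes₁ (suc zero) zero) r)))
               (λ r → ⊥-elim (O₁.<-asym r y₁<₁x₁)))
          where
          1≮0 : ¬ (suc {2} zero <ᶠ zero {2})
          1≮0 ()

        image : (g u <₁ g v ⇔ A₀) × (g u <₂ g v ⇔ B₀)
        image =
          ⇔.sym (proj₁ (proj₂ copy)) ⟨⇔⟩
            O₁.<-via-pivot (g x₀ O₁.<? g y₀) (g-x′≢ λ ()) (g-x′≢ λ ())
              (proj₁ (proj₂ above)) (proj₁ (proj₂ below) ⟨⇔⟩ flip₁) ,
          ⇔.sym (proj₂ (proj₂ copy)) ⟨⇔⟩
            O₂.<-via-pivot (g x₀ O₂.<? g y₀) (g-x′≢ λ ()) (g-x′≢ λ ())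
              (proj₂ (proj₂ above)) (proj₂ (proj₂ below) ⟨⇔⟩ flip₂)

      increasing-uniform : ∀ {u v u′ v′} → SameCuts y u → SameCuts y v → SameCuts y u′ → SameCuts y v′ →
        u <₁ v → u′ <₁ v′ → SamePairType (g u) (g v) (g u′) (g v′)
      increasing-uniform {u} {v} {u′} {v′} su sv su′ sv′ u<v u′<v′ =
        mk⇔ (λ q → ⊥-elim (O₁.<⇒≢ u<v (g-injective q)))
            (λ q → ⊥-elim (O₁.<⇒≢ u′<v′ (g-injective q))) ,
        proj₁ t ⟨⇔⟩ ⇔.sym (proj₁ t′) , proj₂ t ⟨⇔⟩ ⇔.sym (proj₂ t′)
        where
        t : (g u <₁ g v ⇔ A₀) × (g u <₂ g v ⇔ B₀)
        t = Pivot.image su sv u<v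
        t′ : (g u′ <₁ g v′ ⇔ A₀) × (g u′ <₂ g v′ ⇔ B₀)
        t′ = Pivot.image su′ sv′ u′<v′

      Aut₁⊆G : ∀ p → IsAut₁ p → G p
      Aut₁⊆G = Aut⊆G-fromTypes _<₁_ related
        where
        inY-copy : ∀ {m} {d : Vector D m} (d-injective : Injective _≡_ _≡_ d) →
          Realization (_<₁_ on d) (_<₂_ on d) (λ _ → y)
        inY-copy {d = d} d-injective = realizeSplit (isStrictTotalOrder-on order₁ d d-injective)
          (isStrictTotalOrder-on order₂ d d-injective) {Lower = λ _ → ⊥} (λ _ → no λ ()) (λ _ _ ())
        related : ∀ {m} (a b : Vector D m) → Injective _≡_ _≡_ a → Injective _≡_ _≡_ b →
          (∀ i j → (a i <₁ a j ⇔ b i <₁ b j)) → a ~ b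
        related {m} a b a-injective b-injective same =
          ~-trans (SameType⇒~ (realizes-SameType a-injective A))
            (~-trans (SameType-g⇒~ pa pb λ i j → image i j (O₁.compare (a i) (a j)))
              (~-sym (SameType⇒~ (realizes-SameType b-injective B))))
          where
          A : Realization (_<₁_ on a) (_<₂_ on a) (λ _ → y)
          A = inY-copy a-injective
          B : Realization (_<₁_ on b) (_<₂_ on b) (λ _ → y)
          B = inY-copy b-injective
          pa pb : Vector D m
          pa = Realization.point A
          pb = Realization.point B
          increasing : ∀ {i j} → a i <₁ a j → SamePairType (g (pa i)) (g (pa j)) (g (pb i)) (g (pb j))
          increasing {i} {j} r = increasing-uniform
            (Realization.sameCuts A i) (Realization.sameCuts A j) (Realization.sameCuts B i) (Realization.sameCuts B j)
            (from (Realization.realizes₁ A i j) r) (from (Realization.realizes₁ B i j) (to (same i j) r))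
          image : ∀ i j → Tri (a i <₁ a j) (a i ≡ a j) (a j <₁ a i) →
            SamePairType (g (pa i)) (g (pa j)) (g (pb i)) (g (pb j))
          image i j (tri< r _ _) = increasing r
          image i j (tri≈ _ q _) =
            subst (λ k → SamePairType (g (pa i)) (g (pa k)) (g (pb i)) (g (pb k))) (a-injective q)
              SamePairType-diagonal
          image i j (tri> _ _ r) = SamePairType-swap (increasing r)

    Aut₁⊆G⊎Aut₂⊆G : (∀ p → IsAut₁ p → G p) ⊎ (∀ p → IsAut₂ p → G p)
    Aut₁⊆G⊎Aut₂⊆G =
      byParity (parity (g x₀ O₁.<? g y₀) (g x₀ O₂.<? g y₀) (g x₁ O₁.<? g y₁) (g x₁ O₂.<? g y₁) st-agrees)
      where
      byParity : ((A₀ ⇔ A₁) × (B₀ ⇔ B₁)) ⊎ ((A₁ ⇔ (¬ A₀)) × (B₁ ⇔ (¬ B₀))) →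
        (∀ p → IsAut₁ p → G p) ⊎ (∀ p → IsAut₂ p → G p)
      byParity (inj₁ (keeps₁ , keeps₂)) = inj₂ (Preserving.Aut₂⊆G keeps₁ keeps₂)
      byParity (inj₂ (flip₁ , flip₂)) = inj₁ (Flipping.Aut₁⊆G flip₁ flip₂)

  ConstantBetween₂⇒Aut₁⊆G⊎Aut₂⊆G : ∀ {x y} → NonConstant x → NonConstant y → Cuts₁.SameCut x y →
    Cuts₂.ConstantBetween x y ⊎ Cuts₂.ConstantBetween y x → Diagonalized x y →
    (∀ p → IsAut₁ p → G p) ⊎ (∀ p → IsAut₂ p → G p)
  ConstantBetween₂⇒Aut₁⊆G⊎Aut₂⊆G x∉c y∉c cut₁ (inj₁ between) d =
    Split.Aut₁⊆G⊎Aut₂⊆G _ _ x∉c y∉c cut₁ between d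
  ConstantBetween₂⇒Aut₁⊆G⊎Aut₂⊆G x∉c y∉c cut₁ (inj₂ between) d =
    Split.Aut₁⊆G⊎Aut₂⊆G _ _ y∉c x∉c (Cuts₁.SameCut-sym cut₁) between (Diagonalized-sym d)

swap₂ : {A B C : Set} → A × B × C → A × C × B
swap₂ (a , b , c) = a , c , b

module _ {D : Set} {_<₁_ _<₂_ : D → D → Set} where

  IsRandomPermutation-swap : BiOrder.IsRandomPermutation _<₁_ _<₂_ → BiOrder.IsRandomPermutation _<₂_ _<₁_
  IsRandomPermutation-swap RP = record
    { countable = countable
    ; order₁ = order₂
    ; order₂ = order₁
    ; homogeneous = λ a b same → let α , (aut₁ , aut₂) , α-maps = homogeneous a b (λ i j → swap₂ (same i j))
                                 in α , (aut₂ , aut₁) , α-maps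
    ; universal = λ R₁ R₂ O₁ O₂ → let e , e-injective , e₂ , e₁ = universal R₂ R₁ O₂ O₁
                                  in e , e-injective , e₁ , e₂ }
    where open BiOrder.IsRandomPermutation RP

  Canonical-swap : ∀ {n} {c : Vector D n} {g : D → D} →
    BiOrder.Canonical _<₁_ _<₂_ c g → BiOrder.Canonical _<₂_ _<₁_ c g
  Canonical-swap canonical a b same i j = swap₂ (canonical a b (λ i j → swap₂ (same i j)) i j)

  st-swap : ∀ {u v} → BiOrder.st _<₁_ _<₂_ u v → BiOrder.st _<₂_ _<₁_ u v
  st-swap = ⊎.map Product.swap Product.swap

lemma3p11 : (D : Set) (_<₁_ _<₂_ : D → D → Set) →
    BiOrder.IsRandomPermutation _<₁_ _<₂_ →
    (G : Perm D → Set) → IsClosedPermGroup G →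
    (∀ p → BiOrder.IsAut _<₁_ _<₂_ p → G p) →
    (n : ℕ) (c : Vector D n) (g : D → D) →
    MonGenerated G g →
    BiOrder.Canonical _<₁_ _<₂_ c g →
    (x y : D) →
    BiOrder.Infinite _<₁_ _<₂_ (BiOrder.Orbit _<₁_ _<₂_ c x) →
    BiOrder.Infinite _<₁_ _<₂_ (BiOrder.Orbit _<₁_ _<₂_ c y) →
    BiOrder.Disjoint _<₁_ _<₂_ (BiOrder.Orbit _<₁_ _<₂_ c x) (BiOrder.Orbit _<₁_ _<₂_ c y) →
    ¬ BiOrder.DiagonalPosition _<₁_ _<₂_ (BiOrder.Orbit _<₁_ _<₂_ c x) (BiOrder.Orbit _<₁_ _<₂_ c y) →
    BiOrder.Diagonalizes _<₁_ _<₂_ g (BiOrder.Orbit _<₁_ _<₂_ c x) (BiOrder.Orbit _<₁_ _<₂_ c y) →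
    (∀ p → BiOrder.IsAut₁ _<₁_ _<₂_ p → G p) ⊎ (∀ p → BiOrder.IsAut₂ _<₁_ _<₂_ p → G p)
lemma3p11 D _<₁_ _<₂_ RP G G-closed Aut⊆G n c g g-generated g-canonical x y x-infinite y-infinite
  disjoint ¬diagonal g-diagonalizes =
  cases (Cuts₁.SameCut⊎ConstantBetween x∉c y∉c) (Cuts₂.SameCut⊎ConstantBetween x∉c y∉c)
  where
  open RandomPermutation RP
  open WithConstants c
  module Π = Generation RP c G G-closed Aut⊆G g g-generated g-canonical
  module Π′ = Generation (IsRandomPermutation-swap RP) c G G-closed
    (λ p (aut₁ , aut₂) → Aut⊆G p (aut₂ , aut₁)) g g-generated
    (Canonical-swap {_<₁_ = _<₁_} {_<₂_} {g = g} g-canonical)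
  x∉c : NonConstant x
  x∉c = Infinite-Orbit⇒NonConstant x-infinite
  y∉c : NonConstant y
  y∉c = Infinite-Orbit⇒NonConstant y-infinite
  diagonalized : Π.Diagonalized x y
  diagonalized = Π.Diagonalizes⇒Diagonalized x∉c y∉c g-diagonalizes
  diagonalized′ : Π′.Diagonalized x y
  diagonalized′ su sv su′ sv′ s = st-swap {_<₁_ = _<₁_} {_<₂_}
    (diagonalized (Product.swap su) (Product.swap sv) (Product.swap su′) (Product.swap sv′)
      (st-swap {_<₁_ = _<₂_} {_<₁_} s))
  cases : Cuts₁.SameCut x y ⊎ Cuts₁.ConstantBetween x y ⊎ Cuts₁.ConstantBetween y x →
          Cuts₂.SameCut x y ⊎ Cuts₂.ConstantBetween x y ⊎ Cuts₂.ConstantBetween y x →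
          (∀ p → IsAut₁ p → G p) ⊎ (∀ p → IsAut₂ p → G p)
  cases (inj₁ cut₁) (inj₁ cut₂) =
    ⊥-elim (disjoint y (SameCuts⇒Orbit x∉c (cut₁ , cut₂)) (SameCuts⇒Orbit y∉c SameCuts-refl))
  cases (inj₂ between₁) (inj₂ between₂) =
    ⊥-elim (¬diagonal (ConstantsBetween⇒DiagonalPosition disjoint between₁ between₂))
  cases (inj₁ cut₁) (inj₂ between₂) =
    Π.ConstantBetween₂⇒Aut₁⊆G⊎Aut₂⊆G x∉c y∉c cut₁ between₂ diagonalized
  cases (inj₂ between₁) (inj₁ cut₂) =
    ⊎.swap (Π′.ConstantBetween₂⇒Aut₁⊆G⊎Aut₂⊆G x∉c y∉c cut₂ between₁ diagonalized′)
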